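{- Let $C_1,\dots,C_m$ be column-Latin squares of order $n$ such that $(C_s,C_t)$ is a transversal representation pair for all $s\ne t$. Then for any column-Latin square $G$ of order $n$, the squares $GC_1,\dots,GC_m$ are column-Latin and $(GC_s,GC_t)$ is a transversal representation pair for all $s\ne t$.
   Context: A column-Latin square of order $n$ is an $n\times n$ array on symbols $\{0,\dots,n-1\}$ (rows, columns indexed $0,\dots,n-1$) in which every column is a permutation of $\{0,\dots,n-1\}$. The composition of column-Latin squares $F,G$ is $FG$ with $(FG)[i,j]=F[G[i,j],j]$. $(A,B)$ is a transversal representation pair (TRP) if for all $i,i',j,j'$: $A[i,j]=B[i',j]$ and $A[i,j']=B[i',j']$ imply $j=j'$. -}

module Defs where

open import Data.Nat using (ℕ)
open import Data.Fin using (Fin)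
open import Relation.Binary.PropositionalEquality using (_≡_)
open import Function.Definitions using (Bijective)

-- A square of order n: entry at row i, column j is  A i j.
Square : ℕ → Set
Square n = Fin n → Fin n → Fin n

ColumnLatin : {n : ℕ} → Square n → Set
ColumnLatin {n} A = ∀ (j : Fin n) → Bijective _≡_ _≡_ (λ i → A i j)

_∘ˢ_ : {n : ℕ} → Square n → Square n → Square n
(F ∘ˢ G) i j = F (G i j) j

TRP : {n : ℕ} → Square n → Square n → Set
TRP {n} A B = ∀ (i i′ j j′ : Fin n) →
  A i j ≡ B i′ j → A i j′ ≡ B i′ j′ → j ≡ j′

{-# OPTIONS --safe #-}
module Submission where

open import Defs
open import Data.Nat using (ℕ)
open import Data.Fin using (Fin)
open import Data.Product using (_×_; _,_; proj₁)
open import Function.Definitions using (Injective)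
open import Function.Construct.Composition using (bijective)
open import Relation.Binary.PropositionalEquality using (_≡_)
open import Relation.Nullary using (¬_)

columnLatin-∘ˢ : {n : ℕ} {F G : Square n} →
  ColumnLatin F → ColumnLatin G → ColumnLatin (F ∘ˢ G)
columnLatin-∘ˢ F-latin G-latin j = bijective _≡_ _≡_ _≡_ (G-latin j) (F-latin j)

TRP-∘ˢ : {n : ℕ} {G A B : Square n} →
  (∀ j → Injective _≡_ _≡_ (λ i → G i j)) →
  TRP A B → TRP (G ∘ˢ A) (G ∘ˢ B)
TRP-∘ˢ G-inj AB-trp i i′ j j′ GAij≡GBi′j GAij′≡GBi′j′ =
  AB-trp i i′ j j′ (G-inj j GAij≡GBi′j) (G-inj j′ GAij′≡GBi′j′)

lemma5 : (n m : ℕ) (C : Fin m → Square n) →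
    (∀ s → ColumnLatin (C s)) →
    (∀ s t → ¬ (s ≡ t) → TRP (C s) (C t)) →
    (G : Square n) → ColumnLatin G →
    (∀ s → ColumnLatin (G ∘ˢ C s)) ×
    (∀ s t → ¬ (s ≡ t) → TRP (G ∘ˢ C s) (G ∘ˢ C t))
lemma5 n m C C-latin C-trp G G-latin =
  (λ s → columnLatin-∘ˢ G-latin (C-latin s)) ,
  (λ s t s≢t → TRP-∘ˢ (λ j → proj₁ (G-latin j)) (C-trp s t s≢t))
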